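{- Let $M=(E,\mathcal{I})$ be a matroid on a finite set $E$ with $r(M)>0$, and let $B\in\mathcal{B}(M)$. Then $|F_M(B)|=r(M)$.
   Context: $\mathcal{B}(M)$ is the family of bases, $r(M)$ the common cardinality of bases, $r(X)$ the rank of $X\subseteq E$ (maximum size of an independent subset of $X$). $s(M)=\{A\in\mathcal{I}: |A|=r(M)-1\}$. For $X\subseteq E$, $K_M(X)=\{a\in E: r(X\cup\{a\})=r(X)+1\}$. $F_M(B)=\{K_M(X): X\in s(M),\ X\subseteq B\}$ (a set, equal members counted once). -}

module Defs where

open import Data.Nat using (ℕ; zero; suc; _<_; _⊔_; _∸_)
import Data.Nat as ℕ
open import Data.Bool using (Bool; true; false)
import Data.Bool.Properties as BoolP
open import Data.Fin using (Fin)
open import Data.Fin.Subset using (Subset; ⊥; ⊤; _⊆_; _∈_; _∉_; _∪_; ⁅_⁆; ∣_∣; inside; outside)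
open import Data.Fin.Subset.Properties using (_⊆?_)
open import Data.Vec using (Vec; []; _∷_; tabulate)
open import Data.Vec.Properties using (≡-dec)
open import Data.List using (List; []; _∷_; map; filter; foldr; _++_; deduplicate; length)
open import Data.Product using (Σ; ∃-syntax; _×_; _,_)
open import Relation.Nullary using (Dec; does)
open import Relation.Nullary.Decidable using (_×-dec_)
open import Relation.Unary using (Decidable)
open import Relation.Binary.PropositionalEquality using (_≡_)
open import Relation.Binary.Definitions using (DecidableEquality)

record Matroid (n : ℕ) : Set₁ where
  field
    Indep     : Subset n → Set
    Indep?    : Decidable Indep
    indep-∅   : Indep ⊥
    indep-⊆   : ∀ {A B} → A ⊆ B → Indep B → Indep A
    indep-aug : ∀ {A B} → Indep A → Indep B → ∣ A ∣ < ∣ B ∣ →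
                ∃[ x ] (x ∈ B × x ∉ A × Indep (A ∪ ⁅ x ⁆))

allSubsets : (n : ℕ) → List (Subset n)
allSubsets zero    = [] ∷ []
allSubsets (suc n) = map (outside ∷_) (allSubsets n) ++ map (inside ∷_) (allSubsets n)

_≟ₛ_ : ∀ {n} → DecidableEquality (Subset n)
_≟ₛ_ = ≡-dec BoolP._≟_

module _ {n : ℕ} (M : Matroid n) where
  open Matroid M

  IsBasis : Subset n → Set
  IsBasis B = Indep B × (∀ A → Indep A → B ⊆ A → A ≡ B)

  rank : Subset n → ℕ
  rank X = foldr _⊔_ 0 (map ∣_∣ (filter (λ A → (A ⊆? X) ×-dec Indep? A) (allSubsets n)))

  rM : ℕ
  rM = rank ⊤

  InS : Subset n → Set
  InS A = Indep A × ∣ A ∣ ≡ rM ∸ 1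

  InS? : Decidable InS
  InS? A = Indep? A ×-dec (∣ A ∣ ℕ.≟ (rM ∸ 1))

  K : Subset n → Subset n
  K X = tabulate (λ a → does (rank (X ∪ ⁅ a ⁆) ℕ.≟ suc (rank X)))

  F : Subset n → List (Subset n)
  F B = deduplicate _≟ₛ_ (map K (filter (λ X → InS? X ×-dec (X ⊆? B)) (allSubsets n)))

  cardF : Subset n → ℕ
  cardF B = length (F B)

module Submission where

-- Subsets X of the basis B are independent, so for a ∈ B the rank of X ∪ {a} is
-- |X| + 1 exactly when a ∉ X, while no a ∈ X lies in K(X). Hence K(X) ∩ B = B ∖ X,
-- and X ↦ K(X) is injective on subsets of B. F(B) is therefore in bijection with
-- the (r − 1)-subsets of the r-element set B, and there are (r choose r − 1) = r of them.

open import Defs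
open import Data.Nat using (ℕ; zero; suc; _+_; _∸_; _⊔_; _≤_; _<_; z≤n; s≤s)
import Data.Nat as ℕ
open import Data.Nat.Properties
  using (≤-trans; m≤m⊔n; m≤n⊔m; ⊔-lub; ≤-antisym; ≰⇒>; n≤1+n; n<1+n; <-irrefl; +-comm; +-identityʳ;
         suc-injective; m∸[m∸n]≡n)
open import Data.Nat.Combinatorics using (_C_; nCk≡nC[n∸k]; nC1≡n; nCk+nC[k+1]≡[n+1]C[k+1])
open import Data.Bool using (true; false)
open import Data.Fin using () renaming (zero to fzero; suc to fsuc)
open import Data.Fin.Subset using (Subset; ⊤; _⊆_; _∈_; _∉_; _∪_; ⁅_⁆; ∣_∣; inside; outside)
open import Data.Fin.Subset.Properties
  using (_⊆?_; _∈?_; ⊆⊤; ⊆-refl; ⊆-antisym; p⊆p∪q; x∈p∪q⁺; x∈p∪q⁻; x∈⁅x⁆; x∈⁅y⁆⇒x≡y;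
         ∪-identityʳ; p⊆q⇒∣p∣≤∣q∣; drop-∷-⊆; out⊆; in⊆in)
open import Data.Vec using ([]; _∷_; here; there; lookup)
open import Data.Vec.Properties using (lookup∘tabulate; []=⇒lookup; lookup⇒[]=; ∷-injectiveʳ)
open import Data.List using (List; []; _∷_; map; filter; foldr; _++_; deduplicate; length)
open import Data.List.Properties using (length-map; length-++; filter-++; filter-all; filter-none; filter-≐)
open import Data.List.Membership.Propositional using () renaming (_∈_ to _∈ₗ_)
open import Data.List.Membership.Propositional.Properties
  using (∈-map⁺; ∈-map⁻; ∈-++⁺ˡ; ∈-++⁺ʳ; ∈-filter⁺; ∈-filter⁻)
open import Data.List.Relation.Unary.All as All using (All; []; _∷_)
import Data.List.Relation.Unary.All.Properties as AllP
open import Data.List.Relation.Unary.Any using (here; there)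
open import Data.List.Relation.Unary.Unique.Propositional using (Unique; []; _∷_)
import Data.List.Relation.Unary.Unique.Propositional.Properties as Unique
open import Data.Product using (∃-syntax; _×_; _,_; proj₁; proj₂)
open import Data.Sum using (inj₁; inj₂)
open import Function using (_∘_)
open import Relation.Nullary using (Dec; yes; no; does; ¬_; contradiction)
open import Relation.Nullary.Decidable using (_×-dec_; dec-true; dec-false)
open import Level using (0ℓ)
open import Relation.Unary using (Pred; Decidable; _≐_)
open import Relation.Binary.Definitions using (DecidableEquality)
open import Relation.Binary.PropositionalEquality
  using (_≡_; _≢_; refl; sym; trans; cong; subst; module ≡-Reasoning)

open ≡-Reasoning

deduplicate-Unique : ∀ {A : Set} (_≟_ : DecidableEquality A) {xs : List A} →
                     Unique xs → deduplicate _≟_ xs ≡ xs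
deduplicate-Unique _≟_ [] = refl
deduplicate-Unique _≟_ {x ∷ xs} (x∉xs ∷ !xs)
  rewrite deduplicate-Unique _≟_ !xs = cong (x ∷_) (filter-all _ x∉xs)

Unique-map⁺-injectiveOn : ∀ {A B : Set} {P : Pred A 0ℓ} (f : A → B) →
                          (∀ {x y} → P x → P y → f x ≡ f y → x ≡ y) →
                          ∀ {xs} → All P xs → Unique xs → Unique (map f xs)
Unique-map⁺-injectiveOn f inj [] [] = []
Unique-map⁺-injectiveOn {P = P} f inj (px ∷ pxs) (x∉xs ∷ !xs) =
  distinct px pxs x∉xs ∷ Unique-map⁺-injectiveOn f inj pxs !xs
  where
  distinct : ∀ {x ys} → P x → All P ys → All (x ≢_) ys → All (f x ≢_) (map f ys)
  distinct px [] [] = []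
  distinct px (py ∷ pys) (x≢y ∷ x≢ys) = (x≢y ∘ inj px py) ∷ distinct px pys x≢ys

module _ {A B : Set} {P : Pred B 0ℓ} {Q : Pred A 0ℓ} (P? : Decidable P) (Q? : Decidable Q) where

  length-filter-map : (f : A → B) → P ∘ f ≐ Q →
                      ∀ xs → length (filter P? (map f xs)) ≡ length (filter Q? xs)
  length-filter-map f _ [] = refl
  length-filter-map f P∘f≐Q (x ∷ xs) with P? (f x) | Q? x
  ... | yes _    | yes _  = cong suc (length-filter-map f P∘f≐Q xs)
  ... | yes pfx  | no ¬qx = contradiction (proj₁ P∘f≐Q pfx) ¬qx
  ... | no ¬pfx  | yes qx = contradiction (proj₂ P∘f≐Q qx) ¬pfx
  ... | no _     | no _   = length-filter-map f P∘f≐Q xs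

length-filter-map-none : ∀ {A B : Set} {P : Pred B 0ℓ} (P? : Decidable P) (f : A → B) →
                         (∀ x → ¬ P (f x)) → ∀ xs → length (filter P? (map f xs)) ≡ 0
length-filter-map-none P? f ¬P∘f xs = cong length (filter-none P? (AllP.map⁺ (All.universal ¬P∘f xs)))

max-upper : ∀ {y} (ys : List ℕ) → y ∈ₗ ys → y ≤ foldr _⊔_ 0 ys
max-upper (x ∷ ys) (here refl) = m≤m⊔n x (foldr _⊔_ 0 ys)
max-upper (x ∷ ys) (there y∈ys) = ≤-trans (max-upper ys y∈ys) (m≤n⊔m x (foldr _⊔_ 0 ys))

max-least : ∀ {m} (ys : List ℕ) → (∀ {y} → y ∈ₗ ys → y ≤ m) → foldr _⊔_ 0 ys ≤ m
max-least [] _ = z≤n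
max-least (x ∷ ys) ys≤m = ⊔-lub (ys≤m (here refl)) (max-least ys (ys≤m ∘ there))

∈-allSubsets : ∀ {n} (X : Subset n) → X ∈ₗ allSubsets n
∈-allSubsets {zero} [] = here refl
∈-allSubsets {suc n} (outside ∷ X) = ∈-++⁺ˡ (∈-map⁺ (outside ∷_) (∈-allSubsets X))
∈-allSubsets {suc n} (inside ∷ X) =
  ∈-++⁺ʳ (map (outside ∷_) (allSubsets n)) (∈-map⁺ (inside ∷_) (∈-allSubsets X))

allSubsets-Unique : ∀ n → Unique (allSubsets n)
allSubsets-Unique zero = [] ∷ []
allSubsets-Unique (suc n) =
  Unique.++⁺ (Unique.map⁺ ∷-injectiveʳ (allSubsets-Unique n))
             (Unique.map⁺ ∷-injectiveʳ (allSubsets-Unique n)) disjoint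
  where
  disjoint : ∀ {X} → ¬ (X ∈ₗ map (outside ∷_) (allSubsets n) × X ∈ₗ map (inside ∷_) (allSubsets n))
  disjoint (p , q) with ∈-map⁻ (outside ∷_) p | ∈-map⁻ (inside ∷_) q
  ... | _ , _ , refl | _ , _ , ()

∣p∪⁅x⁆∣≡1+∣p∣ : ∀ {n} (p : Subset n) {x} → x ∉ p → ∣ p ∪ ⁅ x ⁆ ∣ ≡ suc ∣ p ∣
∣p∪⁅x⁆∣≡1+∣p∣ (outside ∷ p) {fzero} _ = cong (suc ∘ ∣_∣) (∪-identityʳ p)
∣p∪⁅x⁆∣≡1+∣p∣ (inside ∷ p) {fzero} x∉p = contradiction here x∉p
∣p∪⁅x⁆∣≡1+∣p∣ (outside ∷ p) {fsuc x} x∉p = ∣p∪⁅x⁆∣≡1+∣p∣ p (x∉p ∘ there)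
∣p∪⁅x⁆∣≡1+∣p∣ (inside ∷ p) {fsuc x} x∉p = cong suc (∣p∪⁅x⁆∣≡1+∣p∣ p (x∉p ∘ there))

p∪⁅x⁆⊆q : ∀ {n} {p q : Subset n} {x} → p ⊆ q → x ∈ q → p ∪ ⁅ x ⁆ ⊆ q
p∪⁅x⁆⊆q {p = p} {x = x} p⊆q x∈q y∈p∪⁅x⁆ with x∈p∪q⁻ p ⁅ x ⁆ y∈p∪⁅x⁆
... | inj₁ y∈p = p⊆q y∈p
... | inj₂ y∈⁅x⁆ = subst (_∈ _) (sym (x∈⁅y⁆⇒x≡y x y∈⁅x⁆)) x∈q

x∈p⇒p∪⁅x⁆≡p : ∀ {n} {p : Subset n} {x} → x ∈ p → p ∪ ⁅ x ⁆ ≡ p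
x∈p⇒p∪⁅x⁆≡p {p = p} x∈p = ⊆-antisym (p∪⁅x⁆⊆q ⊆-refl x∈p) (p⊆p∪q _)

_⊆∧∣_∣≡_ : ∀ {n} → Subset n → Subset n → ℕ → Set
X ⊆∧∣ B ∣≡ k = X ⊆ B × ∣ X ∣ ≡ k

⊆∧∣_∣≡?_ : ∀ {n} (B : Subset n) k → Decidable (_⊆∧∣ B ∣≡ k)
(⊆∧∣ B ∣≡? k) X = (X ⊆? B) ×-dec (∣ X ∣ ℕ.≟ k)

count-subsets : ∀ {n} (B : Subset n) k → length (filter (⊆∧∣ B ∣≡? k) (allSubsets n)) ≡ ∣ B ∣ C k
count-subsets {zero} [] zero = refl
count-subsets {zero} [] (suc k) = refl
count-subsets {suc n} (b ∷ B) k = begin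
  length (filter P? (map (outside ∷_) S ++ map (inside ∷_) S))
    ≡⟨ cong length (filter-++ P? (map (outside ∷_) S) (map (inside ∷_) S)) ⟩
  length (filter P? (map (outside ∷_) S) ++ filter P? (map (inside ∷_) S))
    ≡⟨ length-++ (filter P? (map (outside ∷_) S)) ⟩
  length (filter P? (map (outside ∷_) S)) + length (filter P? (map (inside ∷_) S))
    ≡⟨ cong (_+ length (filter P? (map (inside ∷_) S)))
            (trans (length-filter-map P? (⊆∧∣ B ∣≡? k) (outside ∷_) outside≐ S) (count-subsets B k)) ⟩
  ∣ B ∣ C k + length (filter P? (map (inside ∷_) S))
    ≡⟨ pascal-step b k ⟩
  ∣ b ∷ B ∣ C k ∎
  where
  S : List (Subset n)
  S = allSubsets n
  P? : Decidable (_⊆∧∣ b ∷ B ∣≡ k)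
  P? = ⊆∧∣ b ∷ B ∣≡? k
  outside≐ : (_⊆∧∣ b ∷ B ∣≡ k) ∘ (outside ∷_) ≐ (_⊆∧∣ B ∣≡ k)
  outside≐ = (λ (X⊆B , ∣X∣≡k) → drop-∷-⊆ X⊆B , ∣X∣≡k) , (λ (X⊆B , ∣X∣≡k) → out⊆ X⊆B , ∣X∣≡k)

  pascal-step : ∀ b k → ∣ B ∣ C k + length (filter (⊆∧∣ b ∷ B ∣≡? k) (map (inside ∷_) S)) ≡ ∣ b ∷ B ∣ C k
  pascal-step outside k =
    trans (cong (∣ B ∣ C k +_) (length-filter-map-none (⊆∧∣ outside ∷ B ∣≡? k) (inside ∷_) X⊈ S))
          (+-identityʳ (∣ B ∣ C k))
    where
    X⊈ : ∀ X → ¬ (inside ∷ X) ⊆∧∣ outside ∷ B ∣≡ k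
    X⊈ X (inside∷X⊆outside∷B , _) with inside∷X⊆outside∷B here
    ... | ()
  pascal-step inside zero =
    cong (1 +_) (length-filter-map-none (⊆∧∣ inside ∷ B ∣≡? 0) (inside ∷_) (λ { X (_ , ()) }) S)
  pascal-step inside (suc k) = begin
    ∣ B ∣ C suc k + length (filter (⊆∧∣ inside ∷ B ∣≡? suc k) (map (inside ∷_) S))
      ≡⟨ cong (∣ B ∣ C suc k +_)
              (trans (length-filter-map (⊆∧∣ inside ∷ B ∣≡? suc k) (⊆∧∣ B ∣≡? k) (inside ∷_) inside≐ S)
                     (count-subsets B k)) ⟩
    ∣ B ∣ C suc k + ∣ B ∣ C k
      ≡⟨ +-comm (∣ B ∣ C suc k) (∣ B ∣ C k) ⟩
    ∣ B ∣ C k + ∣ B ∣ C suc k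
      ≡⟨ nCk+nC[k+1]≡[n+1]C[k+1] ∣ B ∣ k ⟩
    suc ∣ B ∣ C suc k ∎
    where
    inside≐ : (_⊆∧∣ inside ∷ B ∣≡ suc k) ∘ (inside ∷_) ≐ (_⊆∧∣ B ∣≡ k)
    inside≐ = (λ (X⊆B , ∣X∣≡k) → drop-∷-⊆ X⊆B , suc-injective ∣X∣≡k) ,
              (λ (X⊆B , ∣X∣≡k) → in⊆in X⊆B , cong suc ∣X∣≡k)

nC[n∸1]≡n : ∀ n → 0 < n → n C (n ∸ 1) ≡ n
nC[n∸1]≡n n@(suc m) _ = begin
  n C m           ≡⟨ nCk≡nC[n∸k] (n≤1+n m) ⟩
  n C (n ∸ m)     ≡⟨ cong (n C_) (m∸[m∸n]≡n {n} {1} (s≤s z≤n)) ⟩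
  n C 1           ≡⟨ nC1≡n n ⟩
  n               ∎

module _ {n : ℕ} (M : Matroid n) where
  open Matroid M

  private
    indepIn? : (X : Subset n) → Decidable (λ A → A ⊆ X × Indep A)
    indepIn? X A = (A ⊆? X) ×-dec Indep? A

  indep⇒∣∣≤rank : ∀ {A X} → A ⊆ X → Indep A → ∣ A ∣ ≤ rank M X
  indep⇒∣∣≤rank {A} {X} A⊆X indA =
    max-upper _ (∈-map⁺ ∣_∣ (∈-filter⁺ (indepIn? X) (∈-allSubsets A) (A⊆X , indA)))

  rank≤ : ∀ {X m} → (∀ {A} → A ⊆ X → Indep A → ∣ A ∣ ≤ m) → rank M X ≤ m
  rank≤ {X} {m} bound = max-least _ λ y∈ → sizes≤ (∈-map⁻ ∣_∣ y∈)
    where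
    sizes≤ : ∀ {y} → ∃[ A ] (A ∈ₗ filter (indepIn? X) (allSubsets n) × y ≡ ∣ A ∣) → y ≤ m
    sizes≤ (A , A∈ , refl) with ∈-filter⁻ (indepIn? X) {xs = allSubsets n} A∈
    ... | _ , A⊆X , indA = bound A⊆X indA

  rank-indep : ∀ {X} → Indep X → rank M X ≡ ∣ X ∣
  rank-indep indX = ≤-antisym (rank≤ (λ A⊆X _ → p⊆q⇒∣p∣≤∣q∣ A⊆X)) (indep⇒∣∣≤rank ⊆-refl indX)

  ∣basis∣≡rM : ∀ {B} → IsBasis M B → ∣ B ∣ ≡ rM M
  ∣basis∣≡rM {B} (indB , maximal) = ≤-antisym (indep⇒∣∣≤rank ⊆⊤ indB) (rank≤ ∣indep∣≤∣B∣)
    where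
    ∣indep∣≤∣B∣ : ∀ {A} → A ⊆ ⊤ → Indep A → ∣ A ∣ ≤ ∣ B ∣
    ∣indep∣≤∣B∣ {A} _ indA with ∣ A ∣ ℕ.≤? ∣ B ∣
    ... | yes ≤ = ≤
    ... | no ≰ with indep-aug indB indA (≰⇒> ≰)
    ... | x , _ , x∉B , indB∪x =
      contradiction (subst (x ∈_) (maximal _ indB∪x (p⊆p∪q ⁅ x ⁆)) (x∈p∪q⁺ (inj₂ (x∈⁅x⁆ x)))) x∉B

  rank-step? : ∀ X c → Dec (rank M (X ∪ ⁅ c ⁆) ≡ suc (rank M X))
  rank-step? X c = rank M (X ∪ ⁅ c ⁆) ℕ.≟ suc (rank M X)

  lookup-K : ∀ X c → lookup (K M X) c ≡ does (rank-step? X c)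
  lookup-K X c = lookup∘tabulate _ c

  ∈K : ∀ {X c} → c ∉ X → Indep (X ∪ ⁅ c ⁆) → c ∈ K M X
  ∈K {X} {c} c∉X indX∪c =
    lookup⇒[]= c (K M X) (trans (lookup-K X c) (dec-true (rank-step? X c) rank-grows))
    where
    rank-grows : rank M (X ∪ ⁅ c ⁆) ≡ suc (rank M X)
    rank-grows = begin
      rank M (X ∪ ⁅ c ⁆) ≡⟨ rank-indep indX∪c ⟩
      ∣ X ∪ ⁅ c ⁆ ∣      ≡⟨ ∣p∪⁅x⁆∣≡1+∣p∣ X c∉X ⟩
      suc ∣ X ∣          ≡⟨ cong suc (rank-indep (indep-⊆ (p⊆p∪q ⁅ c ⁆) indX∪c)) ⟨
      suc (rank M X)     ∎

  ∉K : ∀ {X c} → c ∈ X → c ∉ K M X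
  ∉K {X} {c} c∈X c∈KX =
    false≢true (trans (sym (dec-false (rank-step? X c) rank-stays))
                      (trans (sym (lookup-K X c)) ([]=⇒lookup c∈KX)))
    where
    rank-stays : rank M (X ∪ ⁅ c ⁆) ≢ suc (rank M X)
    rank-stays eq = <-irrefl (trans (cong (rank M) (sym (x∈p⇒p∪⁅x⁆≡p c∈X))) eq) (n<1+n (rank M X))
    false≢true : false ≢ true
    false≢true ()

  K-injectiveOn-indep : ∀ {B X Y} → Indep B → X ⊆ B → Y ⊆ B → K M X ≡ K M Y → X ≡ Y
  K-injectiveOn-indep {B} indB X⊆B Y⊆B KX≡KY =
    ⊆-antisym (K≡⇒⊆ X⊆B Y⊆B KX≡KY) (K≡⇒⊆ Y⊆B X⊆B (sym KX≡KY))
    where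
    K≡⇒⊆ : ∀ {X Y} → X ⊆ B → Y ⊆ B → K M X ≡ K M Y → X ⊆ Y
    K≡⇒⊆ {X} {Y} X⊆B Y⊆B KX≡KY {c} c∈X with c ∈? Y
    ... | yes c∈Y = c∈Y
    ... | no c∉Y = contradiction (subst (c ∈_) (sym KX≡KY) c∈KY) (∉K c∈X)
      where
      c∈KY : c ∈ K M Y
      c∈KY = ∈K c∉Y (indep-⊆ (p∪⁅x⁆⊆q Y⊆B (X⊆B c∈X)) indB)

  InS∧⊆indep≐ : ∀ {B} → Indep B → (λ X → InS M X × X ⊆ B) ≐ (_⊆∧∣ B ∣≡ (rM M ∸ 1))
  InS∧⊆indep≐ indB = (λ ((_ , ∣X∣≡r-1) , X⊆B) → X⊆B , ∣X∣≡r-1) ,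
                     (λ (X⊆B , ∣X∣≡r-1) → (indep-⊆ X⊆B indB , ∣X∣≡r-1) , X⊆B)

proposition2 : (n : ℕ) (M : Matroid n) (B : Subset n) →
               0 < rM M → IsBasis M B → cardF M B ≡ rM M
proposition2 n M B 0<r basis@(indB , _) = begin
  length (deduplicate _≟ₛ_ (map (K M) sM∩⊆B)) ≡⟨ cong length (deduplicate-Unique _≟ₛ_ K-distinct) ⟩
  length (map (K M) sM∩⊆B)                   ≡⟨ length-map (K M) sM∩⊆B ⟩
  length sM∩⊆B                               ≡⟨ cong length (filter-≐ inS∧⊆B? (⊆∧∣ B ∣≡? r-1) (InS∧⊆indep≐ M indB) S) ⟩
  length (filter (⊆∧∣ B ∣≡? r-1) S)           ≡⟨ count-subsets B r-1 ⟩
  ∣ B ∣ C r-1                                 ≡⟨ cong (_C r-1) (∣basis∣≡rM M basis) ⟩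
  rM M C r-1                                  ≡⟨ nC[n∸1]≡n (rM M) 0<r ⟩
  rM M                                        ∎
  where
  S : List (Subset n)
  S = allSubsets n
  r-1 : ℕ
  r-1 = rM M ∸ 1
  inS∧⊆B? : Decidable (λ X → InS M X × X ⊆ B)
  inS∧⊆B? X = InS? M X ×-dec (X ⊆? B)
  sM∩⊆B : List (Subset n)
  sM∩⊆B = filter inS∧⊆B? S
  K-distinct : Unique (map (K M) sM∩⊆B)
  K-distinct = Unique-map⁺-injectiveOn (K M) (K-injectiveOn-indep M indB)
                 (All.map proj₂ (AllP.all-filter inS∧⊆B? S)) (Unique.filter⁺ inS∧⊆B? (allSubsets-Unique n))
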